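{- For positive integers $n$ and $j$, $$B_{n+j} = \sum_{k=1}^n P_j(k){n \brace k},$$ where $P_j(x)$ is the degree $j$ polynomial $P_j(x)=\sum_{r=0}^{j}B_{j-r}{j \choose r}x^r$.
   Context: For a nonnegative integer $n$, the Bell number $B_n$ is the number of partitions of an $n$-element set into nonempty subsets (so $B_0=1$). For integers $n,k$, the Stirling number of the second kind ${n \brace k}$ is the number of partitions of an $n$-element set into exactly $k$ nonempty subsets. -}

module Defs where

open import Data.Nat using (ℕ; zero; suc; _+_; _*_; _^_)
open import Data.Nat.Combinatorics using (_C_)

sumFrom : (ℕ → ℕ) → ℕ → ℕ → ℕ
sumFrom f m zero    = 0
sumFrom f m (suc n) = f m + sumFrom f (suc m) n

-- Σ_{k=a}^{b} f k  (empty if b < a)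
sumFromTo : (ℕ → ℕ) → ℕ → ℕ → ℕ
sumFromTo f a b = sumFrom f a (suc b Data.Nat.∸ a)

-- Stirling numbers of the second kind {n brace k}: number of partitions of an
-- n-set into exactly k nonempty blocks, via the standard recurrence
-- S(0,0)=1, S(0,k+1)=0, S(n+1,0)=0, S(n+1,k+1) = (k+1) S(n,k+1) + S(n,k).
stirling2 : ℕ → ℕ → ℕ
stirling2 zero    zero    = 1
stirling2 zero    (suc k) = 0
stirling2 (suc n) zero    = 0
stirling2 (suc n) (suc k) = suc k * stirling2 n (suc k) + stirling2 n k

bell : ℕ → ℕ
bell n = sumFromTo (stirling2 n) 0 n

P : ℕ → ℕ → ℕ
P j x = sumFromTo (λ r → bell (j Data.Nat.∸ r) * (j C r) * x ^ r) 0 j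

-- extensions j k counts the ways to add j new points to a set already partitioned
-- into k blocks: the first new point joins one of the k blocks or opens a new one.
-- Grouping the partitions of an (n+j)-set by their restriction to the first n points
-- gives B (n+j) = Σ_k S(n,k) · extensions j k. Grouping instead by the r new points
-- that land in old blocks gives extensions j k = Σ_r C(j,r) k^r B (j-r) = P j k; from
-- the recurrence this is the binomial identity extensions j (a+b) =
-- Σ_r C(j,r) a^r extensions (j-r) b at b = 0, since extensions m 0 = B m.
module Submission where

open import Defs
open import Data.Nat using (ℕ; zero; suc; _+_; _*_; _∸_; _^_; _<_; _≤_; _≥_; z≤n; s≤s)
open import Data.Nat.Properties
open import Data.Nat.Combinatorics using (_C_; nCk+nC[k+1]≡[n+1]C[k+1]; k>n⇒nCk≡0)
open import Data.Nat.Tactic.RingSolver using (solve-∀)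
open import Relation.Binary.PropositionalEquality
  using (_≡_; refl; sym; trans; cong; cong₂; module ≡-Reasoning)
open ≡-Reasoning

sumBelow : (ℕ → ℕ) → ℕ → ℕ
sumBelow f zero    = 0
sumBelow f (suc N) = f 0 + sumBelow (λ i → f (suc i)) N

sumBelow-cong< : ∀ {f g : ℕ → ℕ} N → (∀ i → i < N → f i ≡ g i) →
                 sumBelow f N ≡ sumBelow g N
sumBelow-cong< zero    f≗g = refl
sumBelow-cong< (suc N) f≗g =
  cong₂ _+_ (f≗g 0 (s≤s z≤n)) (sumBelow-cong< N (λ i i<N → f≗g (suc i) (s≤s i<N)))

sumBelow-cong : ∀ {f g : ℕ → ℕ} N → (∀ i → f i ≡ g i) → sumBelow f N ≡ sumBelow g N
sumBelow-cong N f≗g = sumBelow-cong< N (λ i _ → f≗g i)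

sumFrom≡sumBelow : ∀ (f : ℕ → ℕ) m N → sumFrom f m N ≡ sumBelow (λ i → f (m + i)) N
sumFrom≡sumBelow f m zero    = refl
sumFrom≡sumBelow f m (suc N) = cong₂ _+_ (cong f (sym (+-identityʳ m)))
  (trans (sumFrom≡sumBelow f (suc m) N) (sumBelow-cong N (λ i → cong f (sym (+-suc m i)))))

sumBelow-+ : ∀ (f g : ℕ → ℕ) N →
             sumBelow (λ i → f i + g i) N ≡ sumBelow f N + sumBelow g N
sumBelow-+ f g zero    = refl
sumBelow-+ f g (suc N) = trans
  (cong (f 0 + g 0 +_) (sumBelow-+ (λ i → f (suc i)) (λ i → g (suc i)) N))
  (+-interchange (f 0) (g 0) _ _)
  where
  +-interchange : ∀ a b c d → a + b + (c + d) ≡ a + c + (b + d)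
  +-interchange = solve-∀

sumBelow-*ˡ : ∀ c (f : ℕ → ℕ) N → sumBelow (λ i → c * f i) N ≡ c * sumBelow f N
sumBelow-*ˡ c f zero    = sym (*-zeroʳ c)
sumBelow-*ˡ c f (suc N) = trans (cong (c * f 0 +_) (sumBelow-*ˡ c (λ i → f (suc i)) N))
  (sym (*-distribˡ-+ c (f 0) _))

sumBelow-last : ∀ (f : ℕ → ℕ) N → sumBelow f (suc N) ≡ sumBelow f N + f N
sumBelow-last f zero    = +-comm (f 0) 0
sumBelow-last f (suc N) = trans (cong (f 0 +_) (sumBelow-last (λ i → f (suc i)) N))
  (sym (+-assoc (f 0) _ _))

sumBelow-lastZero : ∀ (f : ℕ → ℕ) N → f N ≡ 0 → sumBelow f (suc N) ≡ sumBelow f N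
sumBelow-lastZero f N fN≡0 = begin
  sumBelow f (suc N)    ≡⟨ sumBelow-last f N ⟩
  sumBelow f N + f N    ≡⟨ cong (sumBelow f N +_) fN≡0 ⟩
  sumBelow f N + 0      ≡⟨ +-identityʳ _ ⟩
  sumBelow f N          ∎

sumBelow-vanishing : ∀ (f : ℕ → ℕ) N M → N ≤ M → (∀ i → N ≤ i → f i ≡ 0) →
                     sumBelow f M ≡ sumBelow f N
sumBelow-vanishing f N M N≤M f≥N≡0 =
  trans (cong (sumBelow f) (sym (m∸n+n≡m N≤M))) (dropZeros (M ∸ N))
  where
  dropZeros : ∀ d → sumBelow f (d + N) ≡ sumBelow f N
  dropZeros zero    = refl
  dropZeros (suc d) =
    trans (sumBelow-lastZero f (d + N) (f≥N≡0 (d + N) (m≤n+m N d))) (dropZeros d)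

sumBelow-pascal : ∀ j (h : ℕ → ℕ) →
  sumBelow (λ r → (j C r) * h (suc r)) (suc j) + sumBelow (λ r → (j C r) * h r) (suc j)
    ≡ sumBelow (λ r → (suc j C r) * h r) (suc (suc j))
sumBelow-pascal j h = begin
  U + sumBelow (λ r → (j C r) * h r) (suc j)
    ≡⟨ cong (U +_) (sym (sumBelow-lastZero (λ r → (j C r) * h r) (suc j) topVanishes)) ⟩
  U + (h₀ + V)
    ≡⟨ +-comm U (h₀ + V) ⟩
  h₀ + V + U
    ≡⟨ +-assoc h₀ V U ⟩
  h₀ + (V + U)
    ≡⟨ cong (h₀ +_) (sumBelow-+ (λ r → (j C suc r) * h (suc r))
                                (λ r → (j C r) * h (suc r)) (suc j)) ⟨
  h₀ + sumBelow (λ r → (j C suc r) * h (suc r) + (j C r) * h (suc r)) (suc j)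
    ≡⟨ cong (h₀ +_) (sumBelow-cong (suc j) pascal) ⟩
  sumBelow (λ r → (suc j C r) * h r) (suc (suc j)) ∎
  where
  h₀ = (j C 0) * h 0
  U = sumBelow (λ r → (j C r) * h (suc r)) (suc j)
  V = sumBelow (λ r → (j C suc r) * h (suc r)) (suc j)
  topVanishes : (j C suc j) * h (suc j) ≡ 0
  topVanishes = cong (_* h (suc j)) (k>n⇒nCk≡0 (n<1+n j))
  pascal : ∀ r → (j C suc r) * h (suc r) + (j C r) * h (suc r) ≡ (suc j C suc r) * h (suc r)
  pascal r = trans (sym (*-distribʳ-+ (h (suc r)) (j C suc r) (j C r)))
    (cong (_* h (suc r)) (trans (+-comm (j C suc r) (j C r)) (nCk+nC[k+1]≡[n+1]C[k+1] j r)))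

n<k⇒stirling2≡0 : ∀ {n k} → n < k → stirling2 n k ≡ 0
n<k⇒stirling2≡0 {zero}  {suc k} _ = refl
n<k⇒stirling2≡0 {suc n} {suc k} (s≤s n<k)
  rewrite n<k⇒stirling2≡0 (m<n⇒m<1+n n<k) | n<k⇒stirling2≡0 n<k =
  trans (+-identityʳ (k * 0)) (*-zeroʳ k)

bell≡sumBelow-stirling2 : ∀ {n N} → n < N → bell n ≡ sumBelow (stirling2 n) N
bell≡sumBelow-stirling2 {n} {N} n<N = begin
  bell n
    ≡⟨ sumFrom≡sumBelow (stirling2 n) 0 (suc n) ⟩
  sumBelow (stirling2 n) (suc n)
    ≡⟨ sumBelow-vanishing (stirling2 n) (suc n) N n<N (λ _ → n<k⇒stirling2≡0) ⟨
  sumBelow (stirling2 n) N ∎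

sumBelow-stirling2-suc : ∀ n N (f : ℕ → ℕ) → n < N →
  sumBelow (λ k → stirling2 (suc n) k * f k) (suc N)
    ≡ sumBelow (λ k → stirling2 n k * (k * f k + f (suc k))) N
sumBelow-stirling2-suc n N f n<N = begin
  sumBelow (λ k → stirling2 (suc n) k * f k) (suc N)
    ≡⟨ sumBelow-cong N (λ k → distributeʳ (suc k) (S (suc k)) (S k) (f (suc k))) ⟩
  sumBelow (λ k → g (suc k) + S k * f (suc k)) N
    ≡⟨ sumBelow-+ (λ k → g (suc k)) (λ k → S k * f (suc k)) N ⟩
  sumBelow g (suc N) + sumBelow (λ k → S k * f (suc k)) N
    ≡⟨ cong (_+ sumBelow (λ k → S k * f (suc k)) N) (sumBelow-lastZero g N gN≡0) ⟩
  sumBelow g N + sumBelow (λ k → S k * f (suc k)) N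
    ≡⟨ sumBelow-+ g (λ k → S k * f (suc k)) N ⟨
  sumBelow (λ k → g k + S k * f (suc k)) N
    ≡⟨ sumBelow-cong N (λ k → sym (distributeˡ (S k) k (f k) (f (suc k)))) ⟩
  sumBelow (λ k → S k * (k * f k + f (suc k))) N ∎
  where
  S : ℕ → ℕ
  S = stirling2 n
  g : ℕ → ℕ
  g k = k * (S k * f k)
  gN≡0 : g N ≡ 0
  gN≡0 = trans (cong (λ s → N * (s * f N)) (n<k⇒stirling2≡0 n<N)) (*-zeroʳ N)
  distributeʳ : ∀ k s t x → (k * s + t) * x ≡ k * (s * x) + t * x
  distributeʳ = solve-∀
  distributeˡ : ∀ s k x y → s * (k * x + y) ≡ k * (s * x) + s * y
  distributeˡ = solve-∀

extensions : ℕ → ℕ → ℕ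
extensions zero    k = 1
extensions (suc j) k = k * extensions j k + extensions j (suc k)

sumBelow-stirling2*extensions : ∀ j n N → n < N →
  sumBelow (λ k → stirling2 n k * extensions j k) N ≡ bell (n + j)
sumBelow-stirling2*extensions zero n N n<N = begin
  sumBelow (λ k → stirling2 n k * 1) N
    ≡⟨ sumBelow-cong N (λ k → *-identityʳ (stirling2 n k)) ⟩
  sumBelow (stirling2 n) N
    ≡⟨ bell≡sumBelow-stirling2 n<N ⟨
  bell n
    ≡⟨ cong bell (+-identityʳ n) ⟨
  bell (n + 0) ∎
sumBelow-stirling2*extensions (suc j) n N n<N = begin
  sumBelow (λ k → stirling2 n k * extensions (suc j) k) N
    ≡⟨ sumBelow-stirling2-suc n N (extensions j) n<N ⟨
  sumBelow (λ k → stirling2 (suc n) k * extensions j k) (suc N)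
    ≡⟨ sumBelow-stirling2*extensions j (suc n) (suc N) (s≤s n<N) ⟩
  bell (suc n + j)
    ≡⟨ cong bell (+-suc n j) ⟨
  bell (n + suc j) ∎

extensions-+ : ∀ j a b →
  extensions j (a + b) ≡ sumBelow (λ r → (j C r) * (a ^ r * extensions (j ∸ r) b)) (suc j)
extensions-+ zero    a b = refl
extensions-+ (suc j) a b = begin
  (a + b) * E j (a + b) + E j (suc (a + b))
    ≡⟨ regroup a b (E j (a + b)) (E j (suc (a + b))) ⟩
  a * E j (a + b) + (b * E j (a + b) + E j (suc (a + b)))
    ≡⟨ cong₂ (λ x y → a * x + (b * x + y)) (extensions-+ j a b)
             (trans (cong (E j) (sym (+-suc a b))) (extensions-+ j a (suc b))) ⟩
  a * T b + (b * T b + T (suc b))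
    ≡⟨ cong₂ _+_ raisePower absorbB ⟩
  sumBelow (λ r → (j C r) * h (suc r)) (suc j) + sumBelow (λ r → (j C r) * h r) (suc j)
    ≡⟨ sumBelow-pascal j h ⟩
  sumBelow (λ r → (suc j C r) * h r) (suc (suc j)) ∎
  where
  E = extensions
  t : ℕ → ℕ → ℕ
  t b′ r = (j C r) * (a ^ r * E (j ∸ r) b′)
  T : ℕ → ℕ
  T b′ = sumBelow (t b′) (suc j)
  h : ℕ → ℕ
  h r = a ^ r * E (suc j ∸ r) b
  regroup : ∀ a b x y → (a + b) * x + y ≡ a * x + (b * x + y)
  regroup = solve-∀
  raisePower : a * T b ≡ sumBelow (λ r → (j C r) * h (suc r)) (suc j)
  raisePower = trans (sym (sumBelow-*ˡ a (t b) (suc j)))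
    (sumBelow-cong (suc j) (λ r → swap a (j C r) (a ^ r) (E (j ∸ r) b)))
    where
    swap : ∀ a c p e → a * (c * (p * e)) ≡ c * (a * p * e)
    swap = solve-∀
  absorbB : b * T b + T (suc b) ≡ sumBelow (λ r → (j C r) * h r) (suc j)
  absorbB = begin
    b * T b + T (suc b)
      ≡⟨ cong (_+ T (suc b)) (sumBelow-*ˡ b (t b) (suc j)) ⟨
    sumBelow (λ r → b * t b r) (suc j) + T (suc b)
      ≡⟨ sumBelow-+ (λ r → b * t b r) (t (suc b)) (suc j) ⟨
    sumBelow (λ r → b * t b r + t (suc b) r) (suc j)
      ≡⟨ sumBelow-cong< (suc j) (λ r r≤j → trans
           (factor b (j C r) (a ^ r) (E (j ∸ r) b) (E (j ∸ r) (suc b)))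
           (cong (λ m → (j C r) * (a ^ r * E m b)) (sym (+-∸-assoc 1 (≤-pred r≤j))))) ⟩
    sumBelow (λ r → (j C r) * h r) (suc j) ∎
    where
    factor : ∀ b c p x y → b * (c * (p * x)) + c * (p * y) ≡ c * (p * (b * x + y))
    factor = solve-∀

extensions-zero≡bell : ∀ m → extensions m 0 ≡ bell m
extensions-zero≡bell m = begin
  extensions m 0              ≡⟨ *-identityˡ (extensions m 0) ⟨
  1 * extensions m 0          ≡⟨ +-identityʳ (1 * extensions m 0) ⟨
  1 * extensions m 0 + 0      ≡⟨ sumBelow-stirling2*extensions m 0 1 (s≤s z≤n) ⟩
  bell m                      ∎

P≡extensions : ∀ j k → P j k ≡ extensions j k
P≡extensions j k = begin
  P j k
    ≡⟨ sumFrom≡sumBelow (λ r → bell (j ∸ r) * (j C r) * k ^ r) 0 (suc j) ⟩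
  sumBelow (λ r → bell (j ∸ r) * (j C r) * k ^ r) (suc j)
    ≡⟨ sumBelow-cong (suc j) (λ r → trans
         (cong (λ x → x * (j C r) * k ^ r) (sym (extensions-zero≡bell (j ∸ r))))
         (rotate (E (j ∸ r) 0) (j C r) (k ^ r))) ⟩
  sumBelow (λ r → (j C r) * (k ^ r * E (j ∸ r) 0)) (suc j)
    ≡⟨ extensions-+ j k 0 ⟨
  E j (k + 0)
    ≡⟨ cong (E j) (+-identityʳ k) ⟩
  E j k ∎
  where
  E = extensions
  rotate : ∀ x y z → x * y * z ≡ y * (z * x)
  rotate = solve-∀

-- The k = 0 term of the first sum vanishes by
-- computation, since stirling2 (suc m) 0 = 0.
theorem1 : (n j : ℕ) → n ≥ 1 → j ≥ 1 →
    bell (n + j) ≡ sumFromTo (λ k → P j k * stirling2 n k) 1 n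
theorem1 (suc m) j _ _ = begin
  bell (suc m + j)
    ≡⟨ sumBelow-stirling2*extensions j (suc m) (suc (suc m)) ≤-refl ⟨
  sumBelow (λ k → stirling2 (suc m) (suc k) * extensions j (suc k)) (suc m)
    ≡⟨ sumBelow-cong (suc m) (λ k → trans
         (*-comm (stirling2 (suc m) (suc k)) (extensions j (suc k)))
         (cong (_* stirling2 (suc m) (suc k)) (sym (P≡extensions j (suc k))))) ⟩
  sumBelow (λ k → P j (suc k) * stirling2 (suc m) (suc k)) (suc m)
    ≡⟨ sumFrom≡sumBelow (λ k → P j k * stirling2 (suc m) k) 1 (suc m) ⟨
  sumFromTo (λ k → P j k * stirling2 (suc m) k) 1 (suc m) ∎
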